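{- For all integers $m,k,j\geq 0$ with $j\ge k$, $$\sum_{C\in\mathscr{C}_{m,k,j}}\prod_{i\geq1}t_i^{u_i(C)}\prod_{i\geq1}s_i^{h_i(C)} =\frac{\mathbf{P}_{k}^{(j-k+1)}\big(1!s_1,2!s_2,\ldots\big)}{k!}\cdot\frac{(j-k)!\,\mathbf{B}_{m,j-k}\big(1!t_1,2!t_2,\ldots\big)}{m!}.$$
   Context: The $t_i,s_i$ are commuting indeterminates. A composition of a nonnegative integer $m$ into $j$ parts is an ordered sequence $(\lambda_1,\ldots,\lambda_j)$ of nonnegative integers summing to $m$. $\mathscr{C}_{m,k,j}$ is the set of compositions of $m$ into $j$ parts exactly $k$ of which are zero. For a composition $C$, $u_i(C)$ is the number of parts equal to $i$ ($i\ge1$), and $h_i(C)$ is the number of maximal runs of consecutive zero parts of length exactly $i$. The partial Bell polynomial is $\mathbf{B}_{n,r}(x_1,x_2,\ldots)=\sum \frac{n!}{r_1!\cdots r_n!}\prod_{i=1}^n\left(\frac{x_i}{i!}\right)^{r_i}$, summed over nonnegative integer solutions of $r_1+\cdots+r_n=r$, $r_1+2r_2+\cdots+nr_n=n$ (so $\mathbf{B}_{0,0}=1$, $\mathbf{B}_{n,0}=0$ for $n\ge1$). For a complex number $\lambda$, the potential polynomials $\mathbf{P}_n^{(\lambda)}(f_1,f_2,\ldots)$ are defined by $1+\sum_{n\geq1}\mathbf{P}_n^{(\lambda)}\frac{u^n}{n!}=\left(1+\sum_{n\ge1}f_n\frac{u^n}{n!}\right)^{\lambda}$, with $\mathbf{P}_0^{(\lambda)}=1$.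 -}

module Defs where

open import Data.Nat as ℕ using (ℕ; zero; suc; _∸_; _!; _≡ᵇ_)
open import Data.Nat.Properties using (_!≢0)
open import Data.Integer using (+_)
open import Data.Rational using (ℚ; 0ℚ; 1ℚ; _+_; _*_; _/_)
open import Data.List using (List; []; _∷_; map; foldr; filterᵇ; concatMap; length; upTo)
open import Data.Nat.ListAction using (sum)
open import Data.Bool using (Bool; true; false; _∧_; if_then_else_)

ℕ→ℚ : ℕ → ℚ
ℕ→ℚ n = + n / 1

inv! : ℕ → ℚ
inv! n = _/_ (+ 1) (n !) {{n !≢0}}

_^ℚ_ : ℚ → ℕ → ℚ
x ^ℚ zero  = 1ℚ
x ^ℚ suc n = x * (x ^ℚ n)

sumℚ : List ℚ → ℚ
sumℚ = foldr _+_ 0ℚ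

prodℚ : List ℚ → ℚ
prodℚ = foldr _*_ 1ℚ

range1 : ℕ → List ℕ
range1 n = map suc (upTo n)

tuples : (len b : ℕ) → List (List ℕ)
tuples zero    b = [] ∷ []
tuples (suc l) b = concatMap (λ a → map (a ∷_) (tuples l b)) (upTo (suc b))

count : (ℕ → Bool) → List ℕ → ℕ
count p xs = length (filterᵇ p xs)

zeros : List ℕ → ℕ
zeros = count (λ x → x ≡ᵇ 0)

-- Enumerated as all length-j tuples with entries in {0..m} (each composition of m
-- appears exactly once), filtered.
Comps : (m k j : ℕ) → List (List ℕ)
Comps m k j = filterᵇ (λ c → (sum c ≡ᵇ m) ∧ (zeros c ≡ᵇ k)) (tuples j m)

u : ℕ → List ℕ → ℕ
u i c = count (λ x → x ≡ᵇ i) c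

-- lengths of the maximal runs of consecutive zero parts
-- (auxiliary: current run length r accumulated so far)
zeroRunsAux : ℕ → List ℕ → List ℕ
zeroRunsAux zero    []            = []
zeroRunsAux (suc r) []            = suc r ∷ []
zeroRunsAux r       (zero ∷ xs)   = zeroRunsAux (suc r) xs
zeroRunsAux zero    (suc _ ∷ xs)  = zeroRunsAux zero xs
zeroRunsAux (suc r) (suc _ ∷ xs)  = suc r ∷ zeroRunsAux zero xs

zeroRuns : List ℕ → List ℕ
zeroRuns = zeroRunsAux zero

h : ℕ → List ℕ → ℕ
h i c = count (λ x → x ≡ᵇ i) (zeroRuns c)

-- The indeterminates are t i, s i (i ≥ 1; index 0 unused).  For C of length
-- len with part sizes ≤ m we have u_i(C) = 0 for i > m and h_i(C) = 0 for
-- i > len, so the infinite products are the finite products below.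
weight : (t s : ℕ → ℚ) (m : ℕ) → List ℕ → ℚ
weight t s m c =
  prodℚ (map (λ i → t i ^ℚ u i c) (range1 m)) *
  prodℚ (map (λ i → s i ^ℚ h i c) (range1 (length c)))

-- Partial Bell polynomial  B_{n,r}(x_1, x_2, ...)
-- = Σ n!/(r_1!⋯r_n!) ∏_{i=1}^n (x_i/i!)^{r_i}
-- over (r_1,…,r_n) ∈ ℕ^n with Σ r_i = r and Σ i r_i = n.

wsum : ℕ → List ℕ → ℕ
wsum i []       = 0
wsum i (r ∷ rs) = i ℕ.* r ℕ.+ wsum (suc i) rs

bellTerm : (ℕ → ℚ) → ℕ → List ℕ → ℚ
bellTerm x i []       = 1ℚ
bellTerm x i (r ∷ rs) = ((x i * inv! i) ^ℚ r) * inv! r * bellTerm x (suc i) rs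

bellB : (n r : ℕ) → (ℕ → ℚ) → ℚ
bellB n r x =
  sumℚ (map (λ rs → ℕ→ℚ (n !) * bellTerm x 1 rs)
            (filterᵇ (λ rs → (sum rs ≡ᵇ r) ∧ (wsum 1 rs ≡ᵇ n)) (tuples n n)))

-- Potential polynomials P_n^{(λ)}(f_1, f_2, ...) for λ ∈ ℕ:
-- 1 + Σ_{n≥1} P_n^{(λ)} u^n/n! = (1 + Σ_{n≥1} f_n u^n/n!)^λ,  P_0^{(λ)} = 1.

baseCoef : (ℕ → ℚ) → ℕ → ℚ
baseCoef f zero    = 1ℚ
baseCoef f (suc n) = f (suc n) * inv! (suc n)

-- coefficient of u^n in F(u)^λ  (Cauchy product)
powCoef : (ℕ → ℚ) → (λ' n : ℕ) → ℚ
powCoef f zero     zero    = 1ℚ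
powCoef f zero     (suc n) = 0ℚ
powCoef f (suc l)  n       =
  sumℚ (map (λ a → baseCoef f a * powCoef f l (n ∸ a)) (upTo (suc n)))

potentialP : (λ' n : ℕ) → (ℕ → ℚ) → ℚ
potentialP l n f = ℕ→ℚ (n !) * powCoef f l n

-- Read a composition from left to right: a positive part a contributes t a and closes the
-- current run of zeros, which contributes s r if it has length r ≥ 1 (and 1 if it is empty).
-- Splitting off the first part gives a recursion in the number of parts whose solution is a
-- product: the j - k positive parts cut the k zeros into j - k + 1 runs, giving the coefficient
-- of uᵏ in (1 + ∑ sᵢ uⁱ)^(j-k+1), i.e. P_k^(j-k+1) / k!, while the positive parts give the
-- coefficient of xᵐ in (∑ tᵢ xⁱ)^(j-k). By the multinomial theorem the latter is
-- (j-k)! B_{m,j-k} / m!; it is proved by differentiating exp (y ∑ tᵢ xⁱ) in y.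

module Submission where

open import Defs
open import Data.Nat as ℕ using (ℕ; zero; suc; _≤_; _<_; _∸_; _!; _≡ᵇ_; z≤n; s≤s; NonZero)
import Data.Nat.Properties as ℕP
open import Data.Nat.ListAction using (sum)
open import Data.Integer as ℤ using () renaming (+_ to pos)
import Data.Integer.Properties as ℤP
import Data.Integer.Solver as ℤSolver
open import Data.Rational using (ℚ; 0ℚ; 1ℚ; _+_; _*_; _/_; fromℚᵘ)
import Data.Rational.Properties as ℚP
open import Data.Rational.Unnormalised as ℚᵘ using (ℚᵘ; mkℚᵘ; *≡*)
import Data.Rational.Unnormalised.Properties as ℚᵘP
open import Data.Rational.Solver using (module +-*-Solver)
open import Data.List using (List; []; _∷_; map; filterᵇ; concatMap; applyUpTo; upTo; length; _++_)
open import Data.List.Properties using (map-∘)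
open import Data.List.Relation.Unary.All as All using (All; []; _∷_)
open import Data.Bool using (Bool; true; false; _∧_; if_then_else_; T)
open import Data.Bool.Properties using (∧-zeroʳ)
open import Data.Unit using (tt)
open import Function using (_∘′_)
open import Relation.Nullary using (yes; no; contradiction)
open import Relation.Binary.PropositionalEquality
open import Algebra.Bundles using (CommutativeMonoid)
open import Algebra.Properties.CommutativeSemigroup
  (CommutativeMonoid.commutativeSemigroup ℚP.*-1-commutativeMonoid)
  using (xy∙z≈y∙zx; xy∙z≈y∙xz; x∙yz≈yx∙z; x∙yz≈y∙xz; interchange)
open import Algebra.Properties.CommutativeSemigroup
  (CommutativeMonoid.commutativeSemigroup ℚP.+-0-commutativeMonoid)
  using () renaming (interchange to +-interchange)
open ≡-Reasoning

-- ℕ→ℚ n is definitionally fromℚᵘ (ℕ→ℚᵘ n).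
ℕ→ℚᵘ : ℕ → ℚᵘ
ℕ→ℚᵘ n = mkℚᵘ (pos n) 0

fromℚᵘ-homo-+ : ∀ p q → fromℚᵘ (p ℚᵘ.+ q) ≡ fromℚᵘ p + fromℚᵘ q
fromℚᵘ-homo-+ p q = ℚP.toℚᵘ-injective (ℚᵘP.≃-trans (ℚP.toℚᵘ-fromℚᵘ (p ℚᵘ.+ q))
  (ℚᵘP.≃-trans (ℚᵘP.+-cong (ℚᵘP.≃-sym (ℚP.toℚᵘ-fromℚᵘ p)) (ℚᵘP.≃-sym (ℚP.toℚᵘ-fromℚᵘ q)))
               (ℚᵘP.≃-sym (ℚP.toℚᵘ-homo-+ (fromℚᵘ p) (fromℚᵘ q)))))

fromℚᵘ-homo-* : ∀ p q → fromℚᵘ (p ℚᵘ.* q) ≡ fromℚᵘ p * fromℚᵘ q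
fromℚᵘ-homo-* p q = ℚP.toℚᵘ-injective (ℚᵘP.≃-trans (ℚP.toℚᵘ-fromℚᵘ (p ℚᵘ.* q))
  (ℚᵘP.≃-trans (ℚᵘP.*-cong (ℚᵘP.≃-sym (ℚP.toℚᵘ-fromℚᵘ p)) (ℚᵘP.≃-sym (ℚP.toℚᵘ-fromℚᵘ q)))
               (ℚᵘP.≃-sym (ℚP.toℚᵘ-homo-* (fromℚᵘ p) (fromℚᵘ q)))))

ℕ→ℚ-+ : ∀ a b → ℕ→ℚ (a ℕ.+ b) ≡ ℕ→ℚ a + ℕ→ℚ b
ℕ→ℚ-+ a b = trans (ℚP.fromℚᵘ-cong {ℕ→ℚᵘ (a ℕ.+ b)} {ℕ→ℚᵘ a ℚᵘ.+ ℕ→ℚᵘ b} (*≡* numerators))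
                  (fromℚᵘ-homo-+ (ℕ→ℚᵘ a) (ℕ→ℚᵘ b))
  where
  open ℤSolver.+-*-Solver
  numerators : pos (a ℕ.+ b) ℤ.* pos 1 ≡ (pos a ℤ.* pos 1 ℤ.+ pos b ℤ.* pos 1) ℤ.* pos 1
  numerators = trans (cong (ℤ._* pos 1) (ℤP.pos-+ a b))
    (solve 2 (λ x y → (x :+ y) :* con (pos 1) := (x :* con (pos 1) :+ y :* con (pos 1)) :* con (pos 1)) refl (pos a) (pos b))

ℕ→ℚ-* : ∀ a b → ℕ→ℚ (a ℕ.* b) ≡ ℕ→ℚ a * ℕ→ℚ b
ℕ→ℚ-* a b = trans (ℚP.fromℚᵘ-cong {ℕ→ℚᵘ (a ℕ.* b)} {ℕ→ℚᵘ a ℚᵘ.* ℕ→ℚᵘ b}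
                                    (*≡* (cong (ℤ._* pos 1) (ℤP.pos-* a b))))
                  (fromℚᵘ-homo-* (ℕ→ℚᵘ a) (ℕ→ℚᵘ b))

1/n*n≡1 : ∀ n {{_ : NonZero n}} → (pos 1 / n) * ℕ→ℚ n ≡ 1ℚ
1/n*n≡1 (suc n) = trans (sym (fromℚᵘ-homo-* (mkℚᵘ (pos 1) n) (ℕ→ℚᵘ (suc n))))
  (ℚP.fromℚᵘ-cong {mkℚᵘ (pos 1) n ℚᵘ.* ℕ→ℚᵘ (suc n)} {mkℚᵘ (pos 1) 0}
    (*≡* (trans (ℤP.*-identityʳ _) (cong (λ d → pos 1 ℤ.* pos d) (sym (ℕP.*-identityʳ (suc n)))))))

inv!*!≡1 : ∀ n → inv! n * ℕ→ℚ (n !) ≡ 1ℚ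
inv!*!≡1 n = 1/n*n≡1 (n !) {{n ℕP.!≢0}}

!*x*inv!≡x : ∀ n x → ℕ→ℚ (n !) * x * inv! n ≡ x
!*x*inv!≡x n x = begin
  ℕ→ℚ (n !) * x * inv! n   ≡⟨ xy∙z≈y∙zx (ℕ→ℚ (n !)) x (inv! n) ⟩
  x * (inv! n * ℕ→ℚ (n !)) ≡⟨ cong (x *_) (inv!*!≡1 n) ⟩
  x * 1ℚ                   ≡⟨ ℚP.*-identityʳ x ⟩
  x                        ∎

suc*inv!suc≡inv! : ∀ r → ℕ→ℚ (suc r) * inv! (suc r) ≡ inv! r
suc*inv!suc≡inv! r = begin
  ℕ→ℚ (suc r) * inv! (suc r)                          ≡⟨ !*x*inv!≡x r _ ⟨
  ℕ→ℚ (r !) * (ℕ→ℚ (suc r) * inv! (suc r)) * inv! r   ≡⟨ cong (_* inv! r) (x∙yz≈yx∙z (ℕ→ℚ (r !)) (ℕ→ℚ (suc r)) (inv! (suc r))) ⟩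
  ℕ→ℚ (suc r) * ℕ→ℚ (r !) * inv! (suc r) * inv! r     ≡⟨ cong (λ x → x * inv! (suc r) * inv! r) (ℕ→ℚ-* (suc r) (r !)) ⟨
  ℕ→ℚ (suc r !) * inv! (suc r) * inv! r               ≡⟨ cong (_* inv! r) (trans (ℚP.*-comm (ℕ→ℚ (suc r !)) (inv! (suc r))) (inv!*!≡1 (suc r))) ⟩
  1ℚ * inv! r                                         ≡⟨ ℚP.*-identityˡ (inv! r) ⟩
  inv! r                                              ∎

if-then-* : ∀ (B : Bool) c x → (if B then c * x else 0ℚ) ≡ c * (if B then x else 0ℚ)
if-then-* true  c x = refl
if-then-* false c x = sym (ℚP.*-zeroʳ c)

∑< : ℕ → (ℕ → ℚ) → ℚ
∑< zero    f = 0ℚ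
∑< (suc n) f = f 0 + ∑< n (λ i → f (suc i))

infixr 5 ∑<
syntax ∑< n (λ i → x) = ∑[ i < n ] x

∏< : ℕ → (ℕ → ℚ) → ℚ
∏< zero    f = 1ℚ
∏< (suc n) f = f 0 * ∏< n (λ i → f (suc i))

infixr 5 ∏<
syntax ∏< n (λ i → x) = ∏[ i < n ] x

∑-cong-< : ∀ n {f g : ℕ → ℚ} → (∀ i → i < n → f i ≡ g i) → ∑< n f ≡ ∑< n g
∑-cong-< zero    eq = refl
∑-cong-< (suc n) eq = cong₂ _+_ (eq 0 (s≤s z≤n)) (∑-cong-< n (λ i i<n → eq (suc i) (s≤s i<n)))

∑-cong : ∀ n {f g : ℕ → ℚ} → (∀ i → f i ≡ g i) → ∑< n f ≡ ∑< n g
∑-cong n eq = ∑-cong-< n (λ i _ → eq i)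

∑-zero : ∀ n → ∑[ i < n ] 0ℚ ≡ 0ℚ
∑-zero zero    = refl
∑-zero (suc n) = trans (ℚP.+-identityˡ _) (∑-zero n)

∑-distrib-+ : ∀ n (f g : ℕ → ℚ) → ∑[ i < n ] (f i + g i) ≡ ∑< n f + ∑< n g
∑-distrib-+ zero    f g = sym (ℚP.+-identityˡ 0ℚ)
∑-distrib-+ (suc n) f g = trans (cong ((f 0 + g 0) +_) (∑-distrib-+ n (λ i → f (suc i)) (λ i → g (suc i))))
                                (+-interchange (f 0) (g 0) _ _)

*-distribˡ-∑ : ∀ n c (f : ℕ → ℚ) → c * ∑< n f ≡ ∑[ i < n ] (c * f i)
*-distribˡ-∑ zero    c f = ℚP.*-zeroʳ c
*-distribˡ-∑ (suc n) c f = trans (ℚP.*-distribˡ-+ c (f 0) _) (cong (c * f 0 +_) (*-distribˡ-∑ n c (λ i → f (suc i))))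

∑-last : ∀ n (f : ℕ → ℚ) → ∑< (suc n) f ≡ ∑< n f + f n
∑-last zero    f = trans (ℚP.+-identityʳ (f 0)) (sym (ℚP.+-identityˡ (f 0)))
∑-last (suc n) f = trans (cong (f 0 +_) (∑-last n (λ i → f (suc i)))) (sym (ℚP.+-assoc (f 0) _ _))

∑-comm : ∀ n m (f : ℕ → ℕ → ℚ) → ∑[ i < n ] ∑[ j < m ] f i j ≡ ∑[ j < m ] ∑[ i < n ] f i j
∑-comm zero    m f = sym (∑-zero m)
∑-comm (suc n) m f = trans (cong (∑< m (f 0) +_) (∑-comm n m (λ i j → f (suc i) j)))
                           (sym (∑-distrib-+ m (f 0) (λ j → ∑[ i < n ] f (suc i) j)))

∏-cong : ∀ n {f g : ℕ → ℚ} → (∀ i → f i ≡ g i) → ∏< n f ≡ ∏< n g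
∏-cong zero    eq = refl
∏-cong (suc n) eq = cong₂ _*_ (eq 0) (∏-cong n (λ i → eq (suc i)))

∏-one : ∀ n → ∏[ i < n ] 1ℚ ≡ 1ℚ
∏-one zero    = refl
∏-one (suc n) = trans (ℚP.*-identityˡ _) (∏-one n)

∏-distrib-* : ∀ n (f g : ℕ → ℚ) → ∏[ i < n ] (f i * g i) ≡ ∏< n f * ∏< n g
∏-distrib-* zero    f g = sym (ℚP.*-identityˡ 1ℚ)
∏-distrib-* (suc n) f g = trans (cong ((f 0 * g 0) *_) (∏-distrib-* n (λ i → f (suc i)) (λ i → g (suc i))))
                                (interchange (f 0) (g 0) _ _)

∏-indicator : ∀ n x (g : ℕ → ℚ) → x < n → ∏[ i < n ] (if x ≡ᵇ i then g i else 1ℚ) ≡ g x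
∏-indicator (suc n) zero    g _         = trans (cong (g 0 *_) (∏-one n)) (ℚP.*-identityʳ (g 0))
∏-indicator (suc n) (suc x) g (s≤s x<n) = trans (ℚP.*-identityˡ _) (∏-indicator n x (λ i → g (suc i)) x<n)

-- shift q f is the coefficient sequence of x^q · ∑ f M xᴹ.
shift : ℕ → (ℕ → ℚ) → ℕ → ℚ
shift zero    f M       = f M
shift (suc q) f zero    = 0ℚ
shift (suc q) f (suc M) = shift q f M

shift-cong : ∀ q {f g : ℕ → ℚ} → (∀ M → f M ≡ g M) → ∀ M → shift q f M ≡ shift q g M
shift-cong zero    eq M       = eq M
shift-cong (suc q) eq zero    = refl
shift-cong (suc q) eq (suc M) = shift-cong q eq M

shift-zero : ∀ q M → shift q (λ _ → 0ℚ) M ≡ 0ℚ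
shift-zero zero    M       = refl
shift-zero (suc q) zero    = refl
shift-zero (suc q) (suc M) = shift-zero q M

*-shift : ∀ q c f M → c * shift q f M ≡ shift q (λ M' → c * f M') M
*-shift zero    c f M       = refl
*-shift (suc q) c f zero    = ℚP.*-zeroʳ c
*-shift (suc q) c f (suc M) = *-shift q c f M

∑-shift : ∀ q n (g : ℕ → ℕ → ℚ) M → ∑[ r < n ] shift q (g r) M ≡ shift q (λ M' → ∑[ r < n ] g r M') M
∑-shift zero    n g M       = refl
∑-shift (suc q) n g zero    = ∑-zero n
∑-shift (suc q) n g (suc M) = ∑-shift q n g M

shift-+ : ∀ a c f M → shift (a ℕ.+ c) f M ≡ shift a (shift c f) M
shift-+ zero    c f M       = refl
shift-+ (suc a) c f zero    = refl
shift-+ (suc a) c f (suc M) = shift-+ a c f M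

shift-comm : ∀ a c f M → shift a (shift c f) M ≡ shift c (shift a f) M
shift-comm a c f M = begin
  shift a (shift c f) M ≡⟨ shift-+ a c f M ⟨
  shift (a ℕ.+ c) f M   ≡⟨ cong (λ q → shift q f M) (ℕP.+-comm a c) ⟩
  shift (c ℕ.+ a) f M   ≡⟨ shift-+ c a f M ⟩
  shift c (shift a f) M ∎

shift-vanishes : ∀ q n {f : ℕ → ℚ} → (∀ M → M < n → f M ≡ 0ℚ) → ∀ M → M < q ℕ.+ n → shift q f M ≡ 0ℚ
shift-vanishes zero    n f<n M       M<n           = f<n M M<n
shift-vanishes (suc q) n f<n zero    _             = refl
shift-vanishes (suc q) n f<n (suc M) (s≤s M<q+n) = shift-vanishes q n f<n M M<q+n

∑-shift-diagonal : ∀ n b (g : ℕ → ℕ → ℚ) → n ≤ b → ∑[ r < suc b ] shift r (g r) n ≡ ∑[ r < suc n ] g r (n ∸ r)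
∑-shift-diagonal zero    b       g _         = cong (g 0 0 +_) (∑-zero b)
∑-shift-diagonal (suc n) (suc b) g (s≤s n≤b) = cong (g 0 (suc n) +_) (∑-shift-diagonal n b (λ r → g (suc r)) n≤b)

∑ᴸ : {A : Set} → List A → (A → ℚ) → ℚ
∑ᴸ xs F = sumℚ (map F xs)

module _ {A : Set} where

  ∑ᴸ-cong : ∀ (xs : List A) {F G : A → ℚ} → (∀ x → F x ≡ G x) → ∑ᴸ xs F ≡ ∑ᴸ xs G
  ∑ᴸ-cong []       eq = refl
  ∑ᴸ-cong (x ∷ xs) eq = cong₂ _+_ (eq x) (∑ᴸ-cong xs eq)

  ∑ᴸ-zero : ∀ (xs : List A) → ∑ᴸ xs (λ _ → 0ℚ) ≡ 0ℚ
  ∑ᴸ-zero []       = refl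
  ∑ᴸ-zero (x ∷ xs) = trans (ℚP.+-identityˡ _) (∑ᴸ-zero xs)

  ∑ᴸ-++ : ∀ (xs ys : List A) F → ∑ᴸ (xs ++ ys) F ≡ ∑ᴸ xs F + ∑ᴸ ys F
  ∑ᴸ-++ []       ys F = sym (ℚP.+-identityˡ _)
  ∑ᴸ-++ (x ∷ xs) ys F = trans (cong (F x +_) (∑ᴸ-++ xs ys F)) (sym (ℚP.+-assoc (F x) _ _))

  *-distribˡ-∑ᴸ : ∀ (xs : List A) c F → c * ∑ᴸ xs F ≡ ∑ᴸ xs (λ x → c * F x)
  *-distribˡ-∑ᴸ []       c F = ℚP.*-zeroʳ c
  *-distribˡ-∑ᴸ (x ∷ xs) c F = trans (ℚP.*-distribˡ-+ c (F x) _) (cong (c * F x +_) (*-distribˡ-∑ᴸ xs c F))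

  ∑ᴸ-filterᵇ : ∀ (p : A → Bool) xs F → sumℚ (map F (filterᵇ p xs)) ≡ ∑ᴸ xs (λ x → if p x then F x else 0ℚ)
  ∑ᴸ-filterᵇ p []       F = refl
  ∑ᴸ-filterᵇ p (x ∷ xs) F with p x
  ... | true  = cong (F x +_) (∑ᴸ-filterᵇ p xs F)
  ... | false = trans (∑ᴸ-filterᵇ p xs F) (sym (ℚP.+-identityˡ _))

  ∑ᴸ-if-* : ∀ (xs : List A) (p : A → Bool) (c : ℚ) (F : A → ℚ) →
    ∑ᴸ xs (λ x → if p x then c * F x else 0ℚ) ≡ c * ∑ᴸ xs (λ x → if p x then F x else 0ℚ)
  ∑ᴸ-if-* xs p c F = trans (∑ᴸ-cong xs (λ x → if-then-* (p x) c (F x)))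
                           (sym (*-distribˡ-∑ᴸ xs c (λ x → if p x then F x else 0ℚ)))

  ∑ᴸ-if-shift : ∀ q (xs : List A) (g : A → ℕ) (P : Bool → A → Bool) (F : A → ℚ) →
    (∀ x → P false x ≡ false) → ∀ M →
    ∑ᴸ xs (λ x → if P (q ℕ.+ g x ≡ᵇ M) x then F x else 0ℚ)
      ≡ shift q (λ M' → ∑ᴸ xs (λ x → if P (g x ≡ᵇ M') x then F x else 0ℚ)) M
  ∑ᴸ-if-shift zero    xs g P F P-false M       = refl
  ∑ᴸ-if-shift (suc q) xs g P F P-false zero    =
    trans (∑ᴸ-cong xs (λ x → cong (λ B → if B then F x else 0ℚ) (P-false x))) (∑ᴸ-zero xs)
  ∑ᴸ-if-shift (suc q) xs g P F P-false (suc M) = ∑ᴸ-if-shift q xs g P F P-false M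

  ∑ᴸ-applyUpTo : ∀ (F : A → ℚ) g n → ∑ᴸ (applyUpTo g n) F ≡ ∑[ i < n ] F (g i)
  ∑ᴸ-applyUpTo F g zero    = refl
  ∑ᴸ-applyUpTo F g (suc n) = cong (F (g 0) +_) (∑ᴸ-applyUpTo F (λ i → g (suc i)) n)

∑ᴸ-map : ∀ {A B : Set} (xs : List A) (h : A → B) F → ∑ᴸ (map h xs) F ≡ ∑ᴸ xs (λ x → F (h x))
∑ᴸ-map xs h F = cong sumℚ (sym (map-∘ xs))

∑ᴸ-concatMap : ∀ {A : Set} (G : ℕ → List A) g n F →
  ∑ᴸ (concatMap G (applyUpTo g n)) F ≡ ∑[ a < n ] ∑ᴸ (G (g a)) F
∑ᴸ-concatMap G g zero    F = refl
∑ᴸ-concatMap G g (suc n) F =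
  trans (∑ᴸ-++ (G (g 0)) _ F) (cong (∑ᴸ (G (g 0)) F +_) (∑ᴸ-concatMap G (λ i → g (suc i)) n F))

∑ᴸ-tuples-suc : ∀ l b F → ∑ᴸ (tuples (suc l) b) F ≡ ∑[ a < suc b ] ∑ᴸ (tuples l b) (λ c → F (a ∷ c))
∑ᴸ-tuples-suc l b F = trans (∑ᴸ-concatMap (λ a → map (a ∷_) (tuples l b)) (λ i → i) (suc b) F)
                            (∑-cong (suc b) (λ a → ∑ᴸ-map (tuples l b) (a ∷_) F))

∑ᴸ-tuples-cong : ∀ l b {F G : List ℕ → ℚ} → (∀ c → All (_≤ b) c → F c ≡ G c) →
  ∑ᴸ (tuples l b) F ≡ ∑ᴸ (tuples l b) G
∑ᴸ-tuples-cong zero    b eq = cong (_+ 0ℚ) (eq [] [])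
∑ᴸ-tuples-cong (suc l) b {F} {G} eq = begin
  ∑ᴸ (tuples (suc l) b) F                             ≡⟨ ∑ᴸ-tuples-suc l b F ⟩
  ∑[ a < suc b ] ∑ᴸ (tuples l b) (λ c → F (a ∷ c))    ≡⟨ ∑-cong-< (suc b) (λ a a<1+b →
                                                            ∑ᴸ-tuples-cong l b (λ c c≤b → eq (a ∷ c) (ℕP.≤-pred a<1+b ∷ c≤b))) ⟩
  ∑[ a < suc b ] ∑ᴸ (tuples l b) (λ c → G (a ∷ c))    ≡⟨ ∑ᴸ-tuples-suc l b G ⟨
  ∑ᴸ (tuples (suc l) b) G                             ∎

δ : ℕ → ℚ
δ zero    = 1ℚ
δ (suc _) = 0ℚ

hat : (ℕ → ℚ) → ℕ → ℚ
hat f zero    = 1ℚ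
hat f (suc i) = f (suc i)

module Powers (t : ℕ → ℚ) where

  -- mulPoly i L f is the coefficient sequence of (∑_{p<L} t (i + p) x^{i+p}) · ∑ f M xᴹ.
  mulPoly : ℕ → ℕ → (ℕ → ℚ) → ℕ → ℚ
  mulPoly i L f M = ∑[ p < L ] t (i ℕ.+ p) * shift (i ℕ.+ p) f M

  -- [xᴹ] (t 1 x + ⋯ + t b xᵇ)ⁿ
  tPow : ℕ → ℕ → ℕ → ℚ
  tPow b zero    = δ
  tPow b (suc n) = mulPoly 1 b (tPow b n)

  mulPoly-cong : ∀ i L {f g : ℕ → ℚ} → (∀ M → f M ≡ g M) → ∀ M → mulPoly i L f M ≡ mulPoly i L g M
  mulPoly-cong i L eq M = ∑-cong L (λ p → cong (t (i ℕ.+ p) *_) (shift-cong (i ℕ.+ p) eq M))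

  mulPoly-zero : ∀ i L M → mulPoly i L (λ _ → 0ℚ) M ≡ 0ℚ
  mulPoly-zero i L M = trans (∑-cong L (λ p → trans (cong (t (i ℕ.+ p) *_) (shift-zero (i ℕ.+ p) M))
                                                    (ℚP.*-zeroʳ (t (i ℕ.+ p)))))
                             (∑-zero L)

  *-mulPoly : ∀ i L c f M → c * mulPoly i L f M ≡ mulPoly i L (λ M' → c * f M') M
  *-mulPoly i L c f M = trans (*-distribˡ-∑ L c _) (∑-cong L (λ p →
    trans (x∙yz≈y∙xz c (t (i ℕ.+ p)) _) (cong (t (i ℕ.+ p) *_) (*-shift (i ℕ.+ p) c f M))))

  shift-mulPoly : ∀ q i L f M → shift q (mulPoly i L f) M ≡ mulPoly i L (shift q f) M
  shift-mulPoly q i L f M = begin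
    shift q (mulPoly i L f) M
      ≡⟨ ∑-shift q L (λ p M' → t (i ℕ.+ p) * shift (i ℕ.+ p) f M') M ⟨
    ∑[ p < L ] shift q (λ M' → t (i ℕ.+ p) * shift (i ℕ.+ p) f M') M
      ≡⟨ ∑-cong L (λ p → *-shift q (t (i ℕ.+ p)) (shift (i ℕ.+ p) f) M) ⟨
    ∑[ p < L ] t (i ℕ.+ p) * shift q (shift (i ℕ.+ p) f) M
      ≡⟨ ∑-cong L (λ p → cong (t (i ℕ.+ p) *_) (shift-comm q (i ℕ.+ p) f M)) ⟩
    mulPoly i L (shift q f) M
      ∎

  ∑-mulPoly : ∀ n i L (g : ℕ → ℕ → ℚ) M →
    ∑[ r < n ] mulPoly i L (g r) M ≡ mulPoly i L (λ M' → ∑[ r < n ] g r M') M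
  ∑-mulPoly n i L g M = begin
    ∑[ r < n ] ∑[ p < L ] t (i ℕ.+ p) * shift (i ℕ.+ p) (g r) M
      ≡⟨ ∑-comm n L (λ r p → t (i ℕ.+ p) * shift (i ℕ.+ p) (g r) M) ⟩
    ∑[ p < L ] ∑[ r < n ] t (i ℕ.+ p) * shift (i ℕ.+ p) (g r) M
      ≡⟨ ∑-cong L (λ p → *-distribˡ-∑ n (t (i ℕ.+ p)) (λ r → shift (i ℕ.+ p) (g r) M)) ⟨
    ∑[ p < L ] t (i ℕ.+ p) * (∑[ r < n ] shift (i ℕ.+ p) (g r) M)
      ≡⟨ ∑-cong L (λ p → cong (t (i ℕ.+ p) *_) (∑-shift (i ℕ.+ p) n g M)) ⟩
    mulPoly i L (λ M' → ∑[ r < n ] g r M') M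
      ∎

  mulPoly-suc : ∀ i L f M → mulPoly i (suc L) f M ≡ t i * shift i f M + mulPoly (suc i) L f M
  mulPoly-suc i L f M = cong₂ _+_ (cong (λ q → t q * shift q f M) (ℕP.+-identityʳ i))
                                  (∑-cong L (λ p → cong (λ q → t q * shift q f M) (ℕP.+-suc i p)))

  tPow-vanishes : ∀ b n M → M < n → tPow b n M ≡ 0ℚ
  tPow-vanishes b (suc n) M M<1+n = trans (∑-cong b vanishing) (∑-zero b)
    where
    vanishing : ∀ p → t (suc p) * shift (suc p) (tPow b n) M ≡ 0ℚ
    vanishing p = trans (cong (t (suc p) *_) (shift-vanishes (suc p) n (tPow-vanishes b n) M
                                                (ℕP.≤-trans M<1+n (s≤s (ℕP.m≤n+m n p)))))
                        (ℚP.*-zeroʳ (t (suc p)))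

module Potential (s : ℕ → ℚ) where

  -- coeffPow n k = [uᵏ] (∑ₐ hat s a uᵃ)ⁿ and openRun r n k = [uᵏ] (∑ₐ hat s (r + a) uᵃ) (∑ₐ hat s a uᵃ)ⁿ.
  coeffPow : ℕ → ℕ → ℚ
  openRun  : ℕ → ℕ → ℕ → ℚ
  coeffPow zero    k = δ k
  coeffPow (suc n) k = openRun 0 n k
  openRun r n zero    = hat s r * coeffPow n zero
  openRun r n (suc k) = hat s r * coeffPow n (suc k) + openRun (suc r) n k

  openRun-convolution : ∀ r n k → openRun r n k ≡ ∑[ a < suc k ] hat s (r ℕ.+ a) * coeffPow n (k ∸ a)
  openRun-convolution r n zero    =
    trans (cong (λ q → hat s q * coeffPow n 0) (sym (ℕP.+-identityʳ r))) (sym (ℚP.+-identityʳ _))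
  openRun-convolution r n (suc k) =
    cong₂ _+_ (cong (λ q → hat s q * coeffPow n (suc k)) (sym (ℕP.+-identityʳ r)))
              (trans (openRun-convolution (suc r) n k)
                     (∑-cong (suc k) (λ a → cong (λ q → hat s q * coeffPow n (k ∸ a)) (sym (ℕP.+-suc r a)))))

  baseCoef≡hat : ∀ a → baseCoef (λ i → ℕ→ℚ (i !) * s i) a ≡ hat s a
  baseCoef≡hat zero    = refl
  baseCoef≡hat (suc a) = !*x*inv!≡x (suc a) (s (suc a))

  powCoef≡coeffPow : ∀ n k → powCoef (λ i → ℕ→ℚ (i !) * s i) n k ≡ coeffPow n k
  powCoef≡coeffPow zero    zero    = refl
  powCoef≡coeffPow zero    (suc k) = refl
  powCoef≡coeffPow (suc n) k = begin
    ∑ᴸ (upTo (suc k)) (λ a → baseCoef fs a * powCoef fs n (k ∸ a))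
      ≡⟨ ∑ᴸ-applyUpTo (λ a → baseCoef fs a * powCoef fs n (k ∸ a)) (λ a → a) (suc k) ⟩
    ∑[ a < suc k ] baseCoef fs a * powCoef fs n (k ∸ a)
      ≡⟨ ∑-cong (suc k) (λ a → cong₂ _*_ (baseCoef≡hat a) (powCoef≡coeffPow n (k ∸ a))) ⟩
    ∑[ a < suc k ] hat s a * coeffPow n (k ∸ a)
      ≡⟨ openRun-convolution 0 n k ⟨
    openRun 0 n k
      ∎
    where
    fs : ℕ → ℚ
    fs i = ℕ→ℚ (i !) * s i

  potentialP*inv!≡coeffPow : ∀ n k → potentialP n k (λ i → ℕ→ℚ (i !) * s i) * inv! k ≡ coeffPow n k
  potentialP*inv!≡coeffPow n k = trans (!*x*inv!≡x k _) (powCoef≡coeffPow n k)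

pow-count-cons : ∀ v i x L →
  v ^ℚ count (_≡ᵇ i) (x ∷ L) ≡ (if x ≡ᵇ i then v else 1ℚ) * v ^ℚ count (_≡ᵇ i) L
pow-count-cons v i x L with x ≡ᵇ i
... | true  = refl
... | false = sym (ℚP.*-identityˡ _)

∏-pow-count : ∀ (f : ℕ → ℚ) N L → All (_≤ N) L →
  ∏[ i < N ] f (suc i) ^ℚ count (_≡ᵇ suc i) L ≡ prodℚ (map (hat f) L)
∏-pow-count f N []      []          = ∏-one N
∏-pow-count f N (x ∷ L) (x≤N ∷ L≤N) = begin
  ∏[ i < N ] f (suc i) ^ℚ count (_≡ᵇ suc i) (x ∷ L)
    ≡⟨ ∏-cong N (λ i → pow-count-cons (f (suc i)) (suc i) x L) ⟩
  ∏[ i < N ] (if x ≡ᵇ suc i then f (suc i) else 1ℚ) * f (suc i) ^ℚ count (_≡ᵇ suc i) L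
    ≡⟨ ∏-distrib-* N (λ i → if x ≡ᵇ suc i then f (suc i) else 1ℚ) (λ i → f (suc i) ^ℚ count (_≡ᵇ suc i) L) ⟩
  (∏[ i < N ] (if x ≡ᵇ suc i then f (suc i) else 1ℚ)) * (∏[ i < N ] f (suc i) ^ℚ count (_≡ᵇ suc i) L)
    ≡⟨ cong₂ _*_ (∏-hat-indicator x x≤N) (∏-pow-count f N L L≤N) ⟩
  hat f x * prodℚ (map (hat f) L)
    ∎
  where
  ∏-hat-indicator : ∀ x → x ≤ N → ∏[ i < N ] (if x ≡ᵇ suc i then f (suc i) else 1ℚ) ≡ hat f x
  ∏-hat-indicator zero    _   = ∏-one N
  ∏-hat-indicator (suc x) x<N = ∏-indicator N x (λ i → f (suc i)) x<N

prodℚ-map-suc-applyUpTo : ∀ (f : ℕ → ℚ) g n → prodℚ (map f (map suc (applyUpTo g n))) ≡ ∏[ i < n ] f (suc (g i))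
prodℚ-map-suc-applyUpTo f g zero    = refl
prodℚ-map-suc-applyUpTo f g (suc n) = cong (f (suc (g 0)) *_) (prodℚ-map-suc-applyUpTo f (λ i → g (suc i)) n)

zeroRunsAux-≤ : ∀ r c → All (_≤ r ℕ.+ length c) (zeroRunsAux r c)
zeroRunsAux-≤ zero    []          = []
zeroRunsAux-≤ (suc r) []          = ℕP.m≤m+n (suc r) 0 ∷ []
zeroRunsAux-≤ zero    (zero ∷ c)  = zeroRunsAux-≤ 1 c
zeroRunsAux-≤ (suc r) (zero ∷ c)  =
  All.map (λ x≤ → ℕP.≤-trans x≤ (ℕP.≤-reflexive (sym (ℕP.+-suc (suc r) (length c))))) (zeroRunsAux-≤ (suc (suc r)) c)
zeroRunsAux-≤ zero    (suc a ∷ c) = All.map ℕP.m≤n⇒m≤1+n (zeroRunsAux-≤ zero c)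
zeroRunsAux-≤ (suc r) (suc a ∷ c) = ℕP.m≤m+n (suc r) _
  ∷ All.map (λ x≤c → ℕP.≤-trans (ℕP.m≤n⇒m≤1+n x≤c) (ℕP.m≤n+m (suc (length c)) (suc r))) (zeroRunsAux-≤ zero c)

module Compositions (t s : ℕ → ℚ) where
  open Powers t
  open Potential s

  -- runWeight r c is the weight of c when a run of r zero parts precedes it.
  runWeight : ℕ → List ℕ → ℚ
  runWeight r []          = hat s r
  runWeight r (zero ∷ c)  = runWeight (suc r) c
  runWeight r (suc a ∷ c) = hat s r * t (suc a) * runWeight 0 c

  prod-hat-runs-cons : ∀ r a c →
    prodℚ (map (hat s) (zeroRunsAux r (suc a ∷ c))) ≡ hat s r * prodℚ (map (hat s) (zeroRuns c))
  prod-hat-runs-cons zero    a c = sym (ℚP.*-identityˡ _)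
  prod-hat-runs-cons (suc r) a c = refl

  prod-hat≡runWeight : ∀ r c → prodℚ (map (hat t) c) * prodℚ (map (hat s) (zeroRunsAux r c)) ≡ runWeight r c
  prod-hat≡runWeight zero    []          = ℚP.*-identityˡ 1ℚ
  prod-hat≡runWeight (suc r) []          = trans (ℚP.*-identityˡ _) (ℚP.*-identityʳ (s (suc r)))
  prod-hat≡runWeight zero    (zero ∷ c)  =
    trans (cong (_* prodℚ (map (hat s) (zeroRunsAux 1 c))) (ℚP.*-identityˡ (prodℚ (map (hat t) c)))) (prod-hat≡runWeight 1 c)
  prod-hat≡runWeight (suc r) (zero ∷ c)  =
    trans (cong (_* prodℚ (map (hat s) (zeroRunsAux (suc (suc r)) c))) (ℚP.*-identityˡ (prodℚ (map (hat t) c))))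
          (prod-hat≡runWeight (suc (suc r)) c)
  prod-hat≡runWeight r       (suc a ∷ c) = begin
    t (suc a) * P * prodℚ (map (hat s) (zeroRunsAux r (suc a ∷ c))) ≡⟨ cong (t (suc a) * P *_) (prod-hat-runs-cons r a c) ⟩
    t (suc a) * P * (hat s r * Z)                                  ≡⟨ interchange (t (suc a)) P (hat s r) Z ⟩
    t (suc a) * hat s r * (P * Z)                                  ≡⟨ cong₂ _*_ (ℚP.*-comm (t (suc a)) (hat s r)) (prod-hat≡runWeight zero c) ⟩
    hat s r * t (suc a) * runWeight 0 c                            ∎
    where
    P Z : ℚ
    P = prodℚ (map (hat t) c)
    Z = prodℚ (map (hat s) (zeroRuns c))

  weight≡runWeight : ∀ m c → All (_≤ m) c → weight t s m c ≡ runWeight 0 c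
  weight≡runWeight m c c≤m = begin
    weight t s m c
      ≡⟨ cong₂ _*_ (prodℚ-map-suc-applyUpTo (λ i → t i ^ℚ u i c) (λ i → i) m)
                   (prodℚ-map-suc-applyUpTo (λ i → s i ^ℚ h i c) (λ i → i) (length c)) ⟩
    (∏[ i < m ] t (suc i) ^ℚ u (suc i) c) * (∏[ i < length c ] s (suc i) ^ℚ h (suc i) c)
      ≡⟨ cong₂ _*_ (∏-pow-count t m c c≤m) (∏-pow-count s (length c) (zeroRuns c) (zeroRunsAux-≤ 0 c)) ⟩
    prodℚ (map (hat t) c) * prodℚ (map (hat s) (zeroRuns c))
      ≡⟨ prod-hat≡runWeight 0 c ⟩
    runWeight 0 c
      ∎

  selects : ℕ → ℕ → List ℕ → Bool
  selects m k c = (sum c ≡ᵇ m) ∧ (zeros c ≡ᵇ k)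

  compSum : (r l b m k : ℕ) → ℚ
  compSum r l b m k = ∑ᴸ (tuples l b) (λ c → if selects m k c then runWeight r c else 0ℚ)

  sum-Comps≡compSum : ∀ m k j → sumℚ (map (weight t s m) (Comps m k j)) ≡ compSum 0 j m m k
  sum-Comps≡compSum m k j = trans (∑ᴸ-filterᵇ (selects m k) (tuples j m) (weight t s m))
    (∑ᴸ-tuples-cong j m (λ c c≤m → cong (λ w → if selects m k c then w else 0ℚ) (weight≡runWeight m c c≤m)))

  compSum-suc : ∀ r l b m k → compSum r (suc l) b m k
    ≡ ∑ᴸ (tuples l b) (λ c → if selects m k (0 ∷ c) then runWeight (suc r) c else 0ℚ)
      + hat s r * mulPoly 1 b (λ m' → compSum 0 l b m' k) m
  compSum-suc r l b m k = trans (∑ᴸ-tuples-suc l b _) (cong (leadingZero +_) (begin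
    ∑[ a < b ] ∑ᴸ (tuples l b) (λ c → if selects m k (suc a ∷ c) then hat s r * t (suc a) * runWeight 0 c else 0ℚ)
      ≡⟨ ∑-cong b positiveHead ⟩
    ∑[ a < b ] hat s r * (t (suc a) * shift (suc a) (λ m' → compSum 0 l b m' k) m)
      ≡⟨ *-distribˡ-∑ b (hat s r) (λ a → t (suc a) * shift (suc a) (λ m' → compSum 0 l b m' k) m) ⟨
    hat s r * mulPoly 1 b (λ m' → compSum 0 l b m' k) m
      ∎))
    where
    leadingZero : ℚ
    leadingZero = ∑ᴸ (tuples l b) (λ c → if selects m k (0 ∷ c) then runWeight (suc r) c else 0ℚ)
    positiveHead : ∀ a →
      ∑ᴸ (tuples l b) (λ c → if selects m k (suc a ∷ c) then hat s r * t (suc a) * runWeight 0 c else 0ℚ)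
        ≡ hat s r * (t (suc a) * shift (suc a) (λ m' → compSum 0 l b m' k) m)
    positiveHead a = begin
      ∑ᴸ (tuples l b) (λ c → if selects m k (suc a ∷ c) then hat s r * t (suc a) * runWeight 0 c else 0ℚ)
        ≡⟨ ∑ᴸ-if-* (tuples l b) (selects m k ∘′ (suc a ∷_)) (hat s r * t (suc a)) (runWeight 0) ⟩
      hat s r * t (suc a) * ∑ᴸ (tuples l b) (λ c → if selects m k (suc a ∷ c) then runWeight 0 c else 0ℚ)
        ≡⟨ cong (hat s r * t (suc a) *_)
             (∑ᴸ-if-shift (suc a) (tuples l b) sum (λ B c → B ∧ (zeros c ≡ᵇ k)) (runWeight 0) (λ _ → refl) m) ⟩
      hat s r * t (suc a) * shift (suc a) (λ m' → compSum 0 l b m' k) m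
        ≡⟨ ℚP.*-assoc (hat s r) (t (suc a)) _ ⟩
      hat s r * (t (suc a) * shift (suc a) (λ m' → compSum 0 l b m' k) m)
        ∎

  compSum-suc-zero : ∀ r l b m → compSum r (suc l) b m 0 ≡ hat s r * mulPoly 1 b (λ m' → compSum 0 l b m' 0) m
  compSum-suc-zero r l b m = trans (compSum-suc r l b m 0)
    (trans (cong (_+ hat s r * mulPoly 1 b (λ m' → compSum 0 l b m' 0) m) noLeadingZero) (ℚP.+-identityˡ _))
    where
    noLeadingZero : ∑ᴸ (tuples l b) (λ c → if selects m 0 (0 ∷ c) then runWeight (suc r) c else 0ℚ) ≡ 0ℚ
    noLeadingZero = trans (∑ᴸ-cong (tuples l b) (λ c → cong (λ B → if B then runWeight (suc r) c else 0ℚ) (∧-zeroʳ (sum c ≡ᵇ m))))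
                          (∑ᴸ-zero (tuples l b))

  compSum-suc-suc : ∀ r l b m k →
    compSum r (suc l) b m (suc k) ≡ compSum (suc r) l b m k + hat s r * mulPoly 1 b (λ m' → compSum 0 l b m' (suc k)) m
  compSum-suc-suc r l b m k = compSum-suc r l b m (suc k)

  compSum-vanishes : ∀ r l b m k → l < k → compSum r l b m k ≡ 0ℚ
  compSum-vanishes r zero    b zero    (suc k) _         = refl
  compSum-vanishes r zero    b (suc m) (suc k) _         = refl
  compSum-vanishes r (suc l) b m       (suc k) (s≤s l<k) = begin
    compSum r (suc l) b m (suc k)
      ≡⟨ compSum-suc-suc r l b m k ⟩
    compSum (suc r) l b m k + hat s r * mulPoly 1 b (λ m' → compSum 0 l b m' (suc k)) m
      ≡⟨ cong₂ _+_ (compSum-vanishes (suc r) l b m k l<k)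
                   (cong (hat s r *_) (trans (mulPoly-cong 1 b (λ m' → compSum-vanishes 0 l b m' (suc k) (ℕP.m≤n⇒m≤1+n l<k)) m)
                                             (mulPoly-zero 1 b m))) ⟩
    0ℚ + hat s r * 0ℚ
      ≡⟨ trans (ℚP.+-identityˡ _) (ℚP.*-zeroʳ (hat s r)) ⟩
    0ℚ
      ∎

  hat*mulPoly-compSum : ∀ r l b m k c f → (∀ m' → compSum 0 l b m' k ≡ c * f m') →
    hat s r * mulPoly 1 b (λ m' → compSum 0 l b m' k) m ≡ hat s r * c * mulPoly 1 b f m
  hat*mulPoly-compSum r l b m k c f eq =
    trans (cong (hat s r *_) (trans (mulPoly-cong 1 b eq m) (sym (*-mulPoly 1 b c f m)))) (sym (ℚP.*-assoc (hat s r) c _))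

  compSum-closedForm : ∀ k n r b m → compSum r (k ℕ.+ n) b m k ≡ openRun r n k * tPow b n m
  compSum-closedForm zero zero r b zero =
    trans (ℚP.+-identityʳ (hat s r)) (sym (trans (ℚP.*-identityʳ _) (ℚP.*-identityʳ (hat s r))))
  compSum-closedForm zero zero r b (suc m) =
    trans (ℚP.+-identityʳ 0ℚ) (sym (ℚP.*-zeroʳ (hat s r * 1ℚ)))
  compSum-closedForm zero (suc n) r b m = begin
    compSum r (suc n) b m 0                             ≡⟨ compSum-suc-zero r n b m ⟩
    hat s r * mulPoly 1 b (λ m' → compSum 0 n b m' 0) m ≡⟨ hat*mulPoly-compSum r n b m 0 (openRun 0 n 0) (tPow b n)
                                                             (compSum-closedForm 0 n 0 b) ⟩
    hat s r * openRun 0 n 0 * tPow b (suc n) m          ∎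
  compSum-closedForm (suc k) zero r b m = begin
    compSum r (suc (k ℕ.+ 0)) b m (suc k)
      ≡⟨ compSum-suc-suc r (k ℕ.+ 0) b m k ⟩
    compSum (suc r) (k ℕ.+ 0) b m k + hat s r * mulPoly 1 b (λ m' → compSum 0 (k ℕ.+ 0) b m' (suc k)) m
      ≡⟨ cong₂ _+_ (compSum-closedForm k zero (suc r) b m) (hat*mulPoly-compSum r (k ℕ.+ 0) b m (suc k) 0ℚ δ tooFewParts) ⟩
    openRun (suc r) 0 k * δ m + hat s r * 0ℚ * tPow b 1 m
      ≡⟨ solve 4 (λ x y z w → x :* y :+ z :* con 0ℚ :* w := (z :* con 0ℚ :+ x) :* y) refl
                 (openRun (suc r) 0 k) (δ m) (hat s r) (tPow b 1 m) ⟩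
    (hat s r * 0ℚ + openRun (suc r) 0 k) * δ m
      ∎
    where
    open +-*-Solver
    tooFewParts : ∀ m' → compSum 0 (k ℕ.+ 0) b m' (suc k) ≡ 0ℚ * δ m'
    tooFewParts m' = trans (compSum-vanishes 0 (k ℕ.+ 0) b m' (suc k) (s≤s (ℕP.≤-reflexive (ℕP.+-identityʳ k))))
                           (sym (ℚP.*-zeroˡ (δ m')))
  compSum-closedForm (suc k) (suc n) r b m = begin
    compSum r (suc (k ℕ.+ suc n)) b m (suc k)
      ≡⟨ compSum-suc-suc r (k ℕ.+ suc n) b m k ⟩
    compSum (suc r) (k ℕ.+ suc n) b m k + hat s r * mulPoly 1 b (λ m' → compSum 0 (k ℕ.+ suc n) b m' (suc k)) m
      ≡⟨ cong₂ _+_ (compSum-closedForm k (suc n) (suc r) b m)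
                   (hat*mulPoly-compSum r (k ℕ.+ suc n) b m (suc k) (openRun 0 n (suc k)) (tPow b n) fewerOpenSlots) ⟩
    openRun (suc r) (suc n) k * tPow b (suc n) m + hat s r * openRun 0 n (suc k) * tPow b (suc n) m
      ≡⟨ trans (ℚP.+-comm (openRun (suc r) (suc n) k * tPow b (suc n) m) (hat s r * openRun 0 n (suc k) * tPow b (suc n) m))
               (sym (ℚP.*-distribʳ-+ (tPow b (suc n) m) (hat s r * openRun 0 n (suc k)) (openRun (suc r) (suc n) k))) ⟩
    (hat s r * openRun 0 n (suc k) + openRun (suc r) (suc n) k) * tPow b (suc n) m
      ∎
    where
    fewerOpenSlots : ∀ m' → compSum 0 (k ℕ.+ suc n) b m' (suc k) ≡ openRun 0 n (suc k) * tPow b n m'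
    fewerOpenSlots m' = trans (cong (λ l → compSum 0 l b m' (suc k)) (ℕP.+-suc k n)) (compSum-closedForm (suc k) n 0 b m')

module Multinomial (t : ℕ → ℚ) where
  open Powers t

  expTerm : ℕ → ℕ → ℚ
  expTerm i r = t i ^ℚ r * inv! r

  -- expCoeff i L n M = [xᴹ yⁿ] ∏_{i ≤ p < i + L} exp (t p · xᵖ · y)
  expCoeff : ℕ → ℕ → ℕ → ℕ → ℚ
  expCoeff i zero    n M = if (0 ≡ᵇ n) ∧ (0 ≡ᵇ M) then 1ℚ else 0ℚ
  expCoeff i (suc L) n M = ∑[ r < suc n ] expTerm i r * shift (i ℕ.* r) (expCoeff (suc i) L (n ∸ r)) M

  expSummand : ℕ → ℕ → ℕ → ℕ → ℕ → ℚ
  expSummand i L n r M = expTerm i r * shift (i ℕ.* r) (expCoeff (suc i) L (n ∸ r)) M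

  expCoeff-zero : ∀ i L M → expCoeff i L 0 M ≡ δ M
  expCoeff-zero i zero    zero    = refl
  expCoeff-zero i zero    (suc M) = refl
  expCoeff-zero i (suc L) M       = begin
    expSummand i L 0 0 M + 0ℚ                              ≡⟨ ℚP.+-identityʳ _ ⟩
    inv! 0 * shift (i ℕ.* 0) (expCoeff (suc i) L 0) M      ≡⟨ cong (λ q → inv! 0 * shift q (expCoeff (suc i) L 0) M) (ℕP.*-zeroʳ i) ⟩
    1ℚ * expCoeff (suc i) L 0 M                            ≡⟨ ℚP.*-identityˡ _ ⟩
    expCoeff (suc i) L 0 M                                 ≡⟨ expCoeff-zero (suc i) L M ⟩
    δ M                                                    ∎

  expTerm-suc : ∀ i r → ℕ→ℚ (suc r) * expTerm i (suc r) ≡ t i * expTerm i r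
  expTerm-suc i r = begin
    ℕ→ℚ (suc r) * (t i * t i ^ℚ r * inv! (suc r)) ≡⟨ solve 4 (λ a x y z → a :* ((x :* y) :* z) := x :* (y :* (a :* z))) refl
                                                       (ℕ→ℚ (suc r)) (t i) (t i ^ℚ r) (inv! (suc r)) ⟩
    t i * (t i ^ℚ r * (ℕ→ℚ (suc r) * inv! (suc r))) ≡⟨ cong (λ z → t i * (t i ^ℚ r * z)) (suc*inv!suc≡inv! r) ⟩
    t i * expTerm i r                               ∎
    where open +-*-Solver

  ∑-index*expSummand : ∀ i L n M →
    ∑[ r < suc (suc n) ] ℕ→ℚ r * expSummand i L (suc n) r M ≡ t i * shift i (expCoeff i (suc L) n) M
  ∑-index*expSummand i L n M = begin
    0ℚ * expSummand i L (suc n) 0 M + (∑[ r < suc n ] ℕ→ℚ (suc r) * expSummand i L (suc n) (suc r) M)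
      ≡⟨ cong₂ _+_ (ℚP.*-zeroˡ (expSummand i L (suc n) 0 M)) (∑-cong (suc n) raise) ⟩
    0ℚ + (∑[ r < suc n ] t i * shift i (expSummand i L n r) M)
      ≡⟨ ℚP.+-identityˡ _ ⟩
    ∑[ r < suc n ] t i * shift i (expSummand i L n r) M
      ≡⟨ *-distribˡ-∑ (suc n) (t i) (λ r → shift i (expSummand i L n r) M) ⟨
    t i * (∑[ r < suc n ] shift i (expSummand i L n r) M)
      ≡⟨ cong (t i *_) (∑-shift i (suc n) (expSummand i L n) M) ⟩
    t i * shift i (expCoeff i (suc L) n) M
      ∎
    where
    raise : ∀ r → ℕ→ℚ (suc r) * expSummand i L (suc n) (suc r) M ≡ t i * shift i (expSummand i L n r) M
    raise r = begin
      ℕ→ℚ (suc r) * (expTerm i (suc r) * shift (i ℕ.* suc r) g M)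
        ≡⟨ ℚP.*-assoc (ℕ→ℚ (suc r)) (expTerm i (suc r)) _ ⟨
      ℕ→ℚ (suc r) * expTerm i (suc r) * shift (i ℕ.* suc r) g M
        ≡⟨ cong₂ _*_ (expTerm-suc i r) (trans (cong (λ q → shift q g M) (ℕP.*-suc i r)) (shift-+ i (i ℕ.* r) g M)) ⟩
      t i * expTerm i r * shift i (shift (i ℕ.* r) g) M
        ≡⟨ ℚP.*-assoc (t i) (expTerm i r) _ ⟩
      t i * (expTerm i r * shift i (shift (i ℕ.* r) g) M)
        ≡⟨ cong (t i *_) (*-shift i (expTerm i r) (shift (i ℕ.* r) g) M) ⟩
      t i * shift i (expSummand i L n r) M
        ∎
      where
      g : ℕ → ℚ
      g = expCoeff (suc i) L (n ∸ r)

  ∑-complement*expSummand : ∀ i L n M →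
    (∀ n' M' → ℕ→ℚ (suc n') * expCoeff (suc i) L (suc n') M' ≡ mulPoly (suc i) L (expCoeff (suc i) L n') M') →
    ∑[ r < suc (suc n) ] ℕ→ℚ (suc n ∸ r) * expSummand i L (suc n) r M ≡ mulPoly (suc i) L (expCoeff i (suc L) n) M
  ∑-complement*expSummand i L n M derivative = begin
    ∑[ r < suc (suc n) ] ℕ→ℚ (suc n ∸ r) * expSummand i L (suc n) r M
      ≡⟨ ∑-last (suc n) (λ r → ℕ→ℚ (suc n ∸ r) * expSummand i L (suc n) r M) ⟩
    (∑[ r < suc n ] ℕ→ℚ (suc n ∸ r) * expSummand i L (suc n) r M) + ℕ→ℚ (suc n ∸ suc n) * expSummand i L (suc n) (suc n) M
      ≡⟨ cong₂ _+_ (∑-cong-< (suc n) lower) lastVanishes ⟩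
    (∑[ r < suc n ] mulPoly (suc i) L (expSummand i L n r) M) + 0ℚ
      ≡⟨ ℚP.+-identityʳ _ ⟩
    ∑[ r < suc n ] mulPoly (suc i) L (expSummand i L n r) M
      ≡⟨ ∑-mulPoly (suc n) (suc i) L (expSummand i L n) M ⟩
    mulPoly (suc i) L (expCoeff i (suc L) n) M
      ∎
    where
    lastVanishes : ℕ→ℚ (suc n ∸ suc n) * expSummand i L (suc n) (suc n) M ≡ 0ℚ
    lastVanishes = trans (cong (λ d → ℕ→ℚ d * expSummand i L (suc n) (suc n) M) (ℕP.n∸n≡0 n))
                         (ℚP.*-zeroˡ (expSummand i L (suc n) (suc n) M))
    lower : ∀ r → r < suc n → ℕ→ℚ (suc n ∸ r) * expSummand i L (suc n) r M ≡ mulPoly (suc i) L (expSummand i L n r) M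
    lower r r<1+n = begin
      ℕ→ℚ (suc n ∸ r) * (expTerm i r * shift (i ℕ.* r) (expCoeff (suc i) L (suc n ∸ r)) M)
        ≡⟨ cong (λ d → ℕ→ℚ d * (expTerm i r * shift (i ℕ.* r) (expCoeff (suc i) L d) M)) (ℕP.+-∸-assoc 1 (ℕP.≤-pred r<1+n)) ⟩
      ℕ→ℚ (suc (n ∸ r)) * (expTerm i r * shift (i ℕ.* r) (expCoeff (suc i) L (suc (n ∸ r))) M)
        ≡⟨ x∙yz≈y∙xz (ℕ→ℚ (suc (n ∸ r))) (expTerm i r) _ ⟩
      expTerm i r * (ℕ→ℚ (suc (n ∸ r)) * shift (i ℕ.* r) (expCoeff (suc i) L (suc (n ∸ r))) M)
        ≡⟨ cong (expTerm i r *_) (trans (*-shift (i ℕ.* r) (ℕ→ℚ (suc (n ∸ r))) (expCoeff (suc i) L (suc (n ∸ r))) M)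
                                        (shift-cong (i ℕ.* r) (derivative (n ∸ r)) M)) ⟩
      expTerm i r * shift (i ℕ.* r) (mulPoly (suc i) L (expCoeff (suc i) L (n ∸ r))) M
        ≡⟨ cong (expTerm i r *_) (shift-mulPoly (i ℕ.* r) (suc i) L (expCoeff (suc i) L (n ∸ r)) M) ⟩
      expTerm i r * mulPoly (suc i) L (shift (i ℕ.* r) (expCoeff (suc i) L (n ∸ r))) M
        ≡⟨ *-mulPoly (suc i) L (expTerm i r) (shift (i ℕ.* r) (expCoeff (suc i) L (n ∸ r))) M ⟩
      mulPoly (suc i) L (expSummand i L n r) M
        ∎

  -- The y-derivative of exp (∑ t p xᵖ y) is (∑ t p xᵖ) · exp (∑ t p xᵖ y).
  expCoeff-derivative : ∀ L i n M → ℕ→ℚ (suc n) * expCoeff i L (suc n) M ≡ mulPoly i L (expCoeff i L n) M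
  expCoeff-derivative zero    i n M = ℚP.*-zeroʳ (ℕ→ℚ (suc n))
  expCoeff-derivative (suc L) i n M = begin
    ℕ→ℚ (suc n) * (∑[ r < suc (suc n) ] X r)
      ≡⟨ *-distribˡ-∑ (suc (suc n)) (ℕ→ℚ (suc n)) X ⟩
    ∑[ r < suc (suc n) ] ℕ→ℚ (suc n) * X r
      ≡⟨ ∑-cong-< (suc (suc n)) split ⟩
    ∑[ r < suc (suc n) ] ℕ→ℚ r * X r + ℕ→ℚ (suc n ∸ r) * X r
      ≡⟨ ∑-distrib-+ (suc (suc n)) (λ r → ℕ→ℚ r * X r) (λ r → ℕ→ℚ (suc n ∸ r) * X r) ⟩
    (∑[ r < suc (suc n) ] ℕ→ℚ r * X r) + (∑[ r < suc (suc n) ] ℕ→ℚ (suc n ∸ r) * X r)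
      ≡⟨ cong₂ _+_ (∑-index*expSummand i L n M) (∑-complement*expSummand i L n M (expCoeff-derivative L (suc i))) ⟩
    t i * shift i (expCoeff i (suc L) n) M + mulPoly (suc i) L (expCoeff i (suc L) n) M
      ≡⟨ mulPoly-suc i L (expCoeff i (suc L) n) M ⟨
    mulPoly i (suc L) (expCoeff i (suc L) n) M
      ∎
    where
    X : ℕ → ℚ
    X r = expSummand i L (suc n) r M
    split : ∀ r → r < suc (suc n) → ℕ→ℚ (suc n) * X r ≡ ℕ→ℚ r * X r + ℕ→ℚ (suc n ∸ r) * X r
    split r r<2+n = begin
      ℕ→ℚ (suc n) * X r               ≡⟨ cong (λ d → ℕ→ℚ d * X r) (ℕP.m+[n∸m]≡n (ℕP.≤-pred r<2+n)) ⟨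
      ℕ→ℚ (r ℕ.+ (suc n ∸ r)) * X r   ≡⟨ cong (_* X r) (ℕ→ℚ-+ r (suc n ∸ r)) ⟩
      (ℕ→ℚ r + ℕ→ℚ (suc n ∸ r)) * X r ≡⟨ ℚP.*-distribʳ-+ (X r) (ℕ→ℚ r) (ℕ→ℚ (suc n ∸ r)) ⟩
      ℕ→ℚ r * X r + ℕ→ℚ (suc n ∸ r) * X r ∎

  !*expCoeff≡tPow : ∀ b n M → ℕ→ℚ (n !) * expCoeff 1 b n M ≡ tPow b n M
  !*expCoeff≡tPow b zero    M = trans (ℚP.*-identityˡ _) (expCoeff-zero 1 b M)
  !*expCoeff≡tPow b (suc n) M = begin
    ℕ→ℚ (suc n !) * expCoeff 1 b (suc n) M             ≡⟨ cong (_* expCoeff 1 b (suc n) M) (ℕ→ℚ-* (suc n) (n !)) ⟩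
    ℕ→ℚ (suc n) * ℕ→ℚ (n !) * expCoeff 1 b (suc n) M   ≡⟨ xy∙z≈y∙xz (ℕ→ℚ (suc n)) (ℕ→ℚ (n !)) _ ⟩
    ℕ→ℚ (n !) * (ℕ→ℚ (suc n) * expCoeff 1 b (suc n) M) ≡⟨ cong (ℕ→ℚ (n !) *_) (expCoeff-derivative b 1 n M) ⟩
    ℕ→ℚ (n !) * mulPoly 1 b (expCoeff 1 b n) M          ≡⟨ *-mulPoly 1 b (ℕ→ℚ (n !)) (expCoeff 1 b n) M ⟩
    mulPoly 1 b (λ M' → ℕ→ℚ (n !) * expCoeff 1 b n M') M ≡⟨ mulPoly-cong 1 b (!*expCoeff≡tPow b n) M ⟩
    tPow b (suc n) M                                     ∎

  t! : ℕ → ℚ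
  t! i = ℕ→ℚ (i !) * t i

  bellSum : ℕ → ℕ → ℕ → ℕ → ℕ → ℚ
  bellSum i L b n M = ∑ᴸ (tuples L b) (λ rs → if (sum rs ≡ᵇ n) ∧ (wsum i rs ≡ᵇ M) then bellTerm t! i rs else 0ℚ)

  bellSum-suc : ∀ L i b n M →
    bellSum i (suc L) b n M ≡ ∑[ r < suc b ] shift r (λ n' → expTerm i r * shift (i ℕ.* r) (bellSum (suc i) L b n') M) n
  bellSum-suc L i b n M = trans (∑ᴸ-tuples-suc L b _) (∑-cong (suc b) firstExponent)
    where
    coeff : ℕ → ℚ
    coeff r = (t! i * inv! i) ^ℚ r * inv! r
    selects : ℕ → Bool → List ℕ → Bool
    selects r B rs = B ∧ (i ℕ.* r ℕ.+ wsum (suc i) rs ≡ᵇ M)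
    firstExponent : ∀ r →
      ∑ᴸ (tuples L b) (λ rs → if selects r (r ℕ.+ sum rs ≡ᵇ n) rs then coeff r * bellTerm t! (suc i) rs else 0ℚ)
        ≡ shift r (λ n' → expTerm i r * shift (i ℕ.* r) (bellSum (suc i) L b n') M) n
    firstExponent r = begin
      ∑ᴸ (tuples L b) (λ rs → if selects r (r ℕ.+ sum rs ≡ᵇ n) rs then coeff r * bellTerm t! (suc i) rs else 0ℚ)
        ≡⟨ ∑ᴸ-if-* (tuples L b) (λ rs → selects r (r ℕ.+ sum rs ≡ᵇ n) rs) (coeff r) (bellTerm t! (suc i)) ⟩
      coeff r * ∑ᴸ (tuples L b) (λ rs → if selects r (r ℕ.+ sum rs ≡ᵇ n) rs then bellTerm t! (suc i) rs else 0ℚ)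
        ≡⟨ cong (coeff r *_) (∑ᴸ-if-shift r (tuples L b) sum (selects r)
                                          (bellTerm t! (suc i)) (λ _ → refl) n) ⟩
      coeff r * shift r (λ n' → ∑ᴸ (tuples L b) (λ rs → if selects r (sum rs ≡ᵇ n') rs then bellTerm t! (suc i) rs else 0ℚ)) n
        ≡⟨ cong₂ _*_ (cong (λ x → x ^ℚ r * inv! r) (!*x*inv!≡x i (t i)))
                     (shift-cong r (λ n' → ∑ᴸ-if-shift (i ℕ.* r) (tuples L b) (wsum (suc i)) (λ B rs → (sum rs ≡ᵇ n') ∧ B)
                                                        (bellTerm t! (suc i)) (λ rs → ∧-zeroʳ (sum rs ≡ᵇ n')) M) n) ⟩
      expTerm i r * shift r (λ n' → shift (i ℕ.* r) (bellSum (suc i) L b n') M) n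
        ≡⟨ *-shift r (expTerm i r) (λ n' → shift (i ℕ.* r) (bellSum (suc i) L b n') M) n ⟩
      shift r (λ n' → expTerm i r * shift (i ℕ.* r) (bellSum (suc i) L b n') M) n
        ∎

  bellSum≡expCoeff : ∀ L i b n M → n ≤ b → bellSum i L b n M ≡ expCoeff i L n M
  bellSum≡expCoeff zero    i b n M _   = ℚP.+-identityʳ _
  bellSum≡expCoeff (suc L) i b n M n≤b = begin
    bellSum i (suc L) b n M
      ≡⟨ bellSum-suc L i b n M ⟩
    ∑[ r < suc b ] shift r (λ n' → expTerm i r * shift (i ℕ.* r) (bellSum (suc i) L b n') M) n
      ≡⟨ ∑-shift-diagonal n b (λ r n' → expTerm i r * shift (i ℕ.* r) (bellSum (suc i) L b n') M) n≤b ⟩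
    ∑[ r < suc n ] expTerm i r * shift (i ℕ.* r) (bellSum (suc i) L b (n ∸ r)) M
      ≡⟨ ∑-cong-< (suc n) (λ r _ → cong (expTerm i r *_) (shift-cong (i ℕ.* r) (λ M' →
           bellSum≡expCoeff L (suc i) b (n ∸ r) M' (ℕP.≤-trans (ℕP.m∸n≤m n r) n≤b)) M)) ⟩
    expCoeff i (suc L) n M
      ∎

  sum≤wsum : ∀ i rs → sum rs ≤ wsum (suc i) rs
  sum≤wsum i []       = z≤n
  sum≤wsum i (r ∷ rs) = ℕP.+-mono-≤ (ℕP.m≤m+n r (i ℕ.* r)) (sum≤wsum (suc i) rs)

  bellSum-vanishes : ∀ L b n M → M < n → bellSum 1 L b n M ≡ 0ℚ
  bellSum-vanishes L b n M M<n = trans (∑ᴸ-cong (tuples L b) unselected) (∑ᴸ-zero (tuples L b))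
    where
    unselected : ∀ rs → (if (sum rs ≡ᵇ n) ∧ (wsum 1 rs ≡ᵇ M) then bellTerm t! 1 rs else 0ℚ) ≡ 0ℚ
    unselected rs with sum rs ≡ᵇ n in sum≡n | wsum 1 rs ≡ᵇ M in wsum≡M
    ... | false | _     = refl
    ... | true  | false = refl
    ... | true  | true  = contradiction
      (subst₂ _≤_ (ℕP.≡ᵇ⇒≡ (sum rs) n (subst T (sym sum≡n) tt)) (ℕP.≡ᵇ⇒≡ (wsum 1 rs) M (subst T (sym wsum≡M) tt))
                  (sum≤wsum 0 rs))
      (ℕP.<⇒≱ M<n)

  !*bellSum≡tPow : ∀ m n → ℕ→ℚ (n !) * bellSum 1 m m n m ≡ tPow m n m
  !*bellSum≡tPow m n with n ℕP.≤? m
  ... | yes n≤m = trans (cong (ℕ→ℚ (n !) *_) (bellSum≡expCoeff m 1 m n m n≤m)) (!*expCoeff≡tPow m n m)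
  ... | no  n≰m = trans (cong (ℕ→ℚ (n !) *_) (bellSum-vanishes m m n m m<n))
                        (trans (ℚP.*-zeroʳ (ℕ→ℚ (n !))) (sym (tPow-vanishes m n m m<n)))
    where
    m<n : m < n
    m<n = ℕP.≰⇒> n≰m

  bellB≡tPow : ∀ m n → ℕ→ℚ (n !) * bellB m n t! * inv! m ≡ tPow m n m
  bellB≡tPow m n = begin
    ℕ→ℚ (n !) * bellB m n t! * inv! m                      ≡⟨ cong (λ x → ℕ→ℚ (n !) * x * inv! m) bellB≡!*bellSum ⟩
    ℕ→ℚ (n !) * (ℕ→ℚ (m !) * bellSum 1 m m n m) * inv! m ≡⟨ cong (_* inv! m) (x∙yz≈y∙xz (ℕ→ℚ (n !)) (ℕ→ℚ (m !)) _) ⟩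
    ℕ→ℚ (m !) * (ℕ→ℚ (n !) * bellSum 1 m m n m) * inv! m ≡⟨ !*x*inv!≡x m _ ⟩
    ℕ→ℚ (n !) * bellSum 1 m m n m                          ≡⟨ !*bellSum≡tPow m n ⟩
    tPow m n m                                             ∎
    where
    bellB≡!*bellSum : bellB m n t! ≡ ℕ→ℚ (m !) * bellSum 1 m m n m
    bellB≡!*bellSum = trans (∑ᴸ-filterᵇ _ (tuples m m) (λ rs → ℕ→ℚ (m !) * bellTerm t! 1 rs))
                            (∑ᴸ-if-* (tuples m m) (λ rs → (sum rs ≡ᵇ n) ∧ (wsum 1 rs ≡ᵇ m)) (ℕ→ℚ (m !)) (bellTerm t! 1))

theorem3p2 : (t s : ℕ → ℚ) (m k j : ℕ) → k ≤ j →
    sumℚ (map (weight t s m) (Comps m k j))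
      ≡ (potentialP (suc (j ∸ k)) k (λ i → ℕ→ℚ (i !) * s i) * inv! k)
        * ((ℕ→ℚ ((j ∸ k) !) * bellB m (j ∸ k) (λ i → ℕ→ℚ (i !) * t i)) * inv! m)
theorem3p2 t s m k j k≤j = begin
  sumℚ (map (weight t s m) (Comps m k j))  ≡⟨ sum-Comps≡compSum m k j ⟩
  compSum 0 j m m k                         ≡⟨ cong (λ l → compSum 0 l m m k) (ℕP.m+[n∸m]≡n k≤j) ⟨
  compSum 0 (k ℕ.+ (j ∸ k)) m m k           ≡⟨ compSum-closedForm k (j ∸ k) 0 m m ⟩
  openRun 0 (j ∸ k) k * tPow m (j ∸ k) m    ≡⟨ cong₂ _*_ (potentialP*inv!≡coeffPow (suc (j ∸ k)) k) (bellB≡tPow m (j ∸ k)) ⟨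
  (potentialP (suc (j ∸ k)) k (λ i → ℕ→ℚ (i !) * s i) * inv! k)
    * ((ℕ→ℚ ((j ∸ k) !) * bellB m (j ∸ k) (λ i → ℕ→ℚ (i !) * t i)) * inv! m) ∎
  where
  open Potential s
  open Powers t
  open Compositions t s
  open Multinomial t
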